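{- Let $\mathbf w$ be an infinite word over $\mathcal A$, $y\in\mathcal A$ a letter, $X\subseteq\mathcal A$, and $u$ a finite word. If $\mathbf w$ is covered by $\{u\}\cup\{ux: x\in X\cup\{y\}\}$, then $L_y(\mathbf w)$ is covered by $\{L_y(u)y\}\cup\{L_y(u)yx: x\in X\setminus\{y\}\}$.
   Context: For $y\in\mathcal A$, $L_y$ is the morphism with $L_y(y)=y$ and $L_y(b)=yb$ for $b\ne y$, applied letterwise to infinite words. A set $Z$ of finite words covers an infinite word $\mathbf w$ if there exist words $(p_n)_{n\ge0}$ and $(z_n)_{n\ge0}$ with $z_n\in Z$, $p_0=\varepsilon$, $p_nz_n$ a prefix of $\mathbf w$ and $|p_n|<|p_{n+1}|\le|p_nz_n|$ for all $n\ge0$. -}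

module Defs where

open import Data.Nat using (ℕ; zero; suc; _<_; _≤_)
open import Data.List using (List; []; _∷_; _++_; length; concatMap)
open import Data.Product using (Σ; _×_; ∃)
open import Relation.Binary.PropositionalEquality using (_≡_)
open import Relation.Nullary using (Dec; yes; no)

Word∞ : Set → Set
Word∞ A = ℕ → A

takeω : {A : Set} → ℕ → Word∞ A → List A
takeω zero    w = []
takeω (suc n) w = w 0 ∷ takeω n (λ i → w (suc i))

IsPrefix : {A : Set} → List A → Word∞ A → Set
IsPrefix v w = v ≡ takeω (length v) w

Covers : {A : Set} → (List A → Set) → Word∞ A → Set
Covers {A} Z w =
  Σ (ℕ → List A) λ p → Σ (ℕ → List A) λ z →
    (p 0 ≡ []) ×
    ((n : ℕ) → Z (z n)) ×
    ((n : ℕ) → IsPrefix (p n ++ z n) w) ×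
    ((n : ℕ) → length (p n) < length (p (suc n))) ×
    ((n : ℕ) → length (p (suc n)) ≤ length (p n ++ z n))

module _ {A : Set} (_≟_ : (a b : A) → Dec (a ≡ b)) where

  Lletter : A → A → List A
  Lletter y b with b ≟ y
  ... | yes _ = y ∷ []
  ... | no  _ = y ∷ b ∷ []

  L : A → List A → List A
  L y = concatMap (Lletter y)

  -- L_y on infinite words: letter n of L_y(w), reading w from position i.
  Lω-from : A → Word∞ A → ℕ → ℕ → A
  Lω-from y w i n with w i ≟ y
  Lω-from y w i zero          | yes _ = y
  Lω-from y w i (suc n)       | yes _ = Lω-from y w (suc i) n
  Lω-from y w i zero          | no  _ = y
  Lω-from y w i (suc zero)    | no  _ = w i
  Lω-from y w i (suc (suc n)) | no  _ = Lω-from y w (suc i) n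

  Lω : A → Word∞ A → Word∞ A
  Lω y w = Lω-from y w 0

-- L_y sends the prefix p ++ z of w to the prefix L_y p ++ L_y z of L_y(w), and it
-- does not shrink words, so the positions L_y(p_n) still grow strictly and the
-- windows still overlap.  The three kinds of cover word transform as follows:
-- L_y(u y) = L_y(u) y and L_y(u x) = L_y(u) y x for x ≠ y, while an occurrence
-- of u is followed by some letter c, whose image L_y(c) begins with y.
module Submission where

open import Defs
open import Data.List using (List; []; _∷_; _++_; length)
open import Data.List.Properties using (∷-injective; length-++; length-++-≤ˡ; ++-assoc; ++-identityʳ; concatMap-++)
open import Data.Nat using (ℕ; zero; suc; _+_; _≤_; _<_; z≤n; s≤s)
open import Data.Nat.Properties
  using (≤-refl; ≤-trans; ≤-reflexive; <⇒≤; m≤m+n; m≤n+m; +-monoʳ-≤; +-monoʳ-<; +-cancelˡ-<; +-identityʳ)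
open import Data.Product using (Σ; _×_; _,_; proj₁; proj₂)
open import Data.Sum using (_⊎_; inj₁; inj₂)
open import Data.Empty using (⊥-elim)
open import Function using (_∘_)
open import Relation.Binary.PropositionalEquality
  using (_≡_; refl; sym; trans; cong; cong₂; subst; module ≡-Reasoning)
open import Relation.Nullary using (Dec; yes; no; ¬_)

module _ {A : Set} where

  takeω-cong : ∀ n {v w : Word∞ A} → (∀ i → v i ≡ w i) → takeω n v ≡ takeω n w
  takeω-cong zero    eq = refl
  takeω-cong (suc n) eq = cong₂ _∷_ (eq 0) (takeω-cong n (eq ∘ suc))

  IsPrefix-++⁻ˡ : ∀ a b {w : Word∞ A} → IsPrefix (a ++ b) w → IsPrefix a w
  IsPrefix-++⁻ˡ []      b eq = refl
  IsPrefix-++⁻ˡ (x ∷ a) b eq =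
    cong₂ _∷_ (proj₁ (∷-injective eq)) (IsPrefix-++⁻ˡ a b (proj₂ (∷-injective eq)))

  IsPrefix-∷ʳ-next : ∀ v {w : Word∞ A} → IsPrefix v w → IsPrefix (v ++ w (length v) ∷ []) w
  IsPrefix-∷ʳ-next []      eq = refl
  IsPrefix-∷ʳ-next (x ∷ v) eq =
    cong₂ _∷_ (proj₁ (∷-injective eq)) (IsPrefix-∷ʳ-next v (proj₂ (∷-injective eq)))

  IsPrefix-≤⇒++ : ∀ a b {w : Word∞ A} → IsPrefix a w → IsPrefix b w →
                  length a ≤ length b → Σ (List A) λ r → b ≡ a ++ r
  IsPrefix-≤⇒++ []      b       _  _  _         = b , refl
  IsPrefix-≤⇒++ (x ∷ a) (x′ ∷ b) pa pb (s≤s a≤b) =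
    let r , b≡a++r = IsPrefix-≤⇒++ a b (proj₂ (∷-injective pa)) (proj₂ (∷-injective pb)) a≤b
    in  r , cong₂ _∷_ (trans (proj₁ (∷-injective pb)) (sym (proj₁ (∷-injective pa)))) b≡a++r

module Morphism {A : Set} (_≟_ : (a b : A) → Dec (a ≡ b)) (y : A) where

  Lʸ : List A → List A
  Lʸ = L _≟_ y

  Lωʸ : Word∞ A → Word∞ A
  Lωʸ = Lω _≟_ y

  Lletter-≡ : Lletter _≟_ y y ≡ y ∷ []
  Lletter-≡ with y ≟ y
  ... | yes _   = refl
  ... | no  y≢y = ⊥-elim (y≢y refl)

  Lletter-≢ : ∀ {x} → ¬ x ≡ y → Lletter _≟_ y x ≡ y ∷ x ∷ []
  Lletter-≢ {x} x≢y with x ≟ y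
  ... | yes x≡y = ⊥-elim (x≢y x≡y)
  ... | no  _   = refl

  Lletter-head : ∀ c → Σ (List A) λ t → Lletter _≟_ y c ≡ y ∷ t
  Lletter-head c with c ≟ y
  ... | yes _ = [] , refl
  ... | no  _ = c ∷ [] , refl

  L-++ : ∀ a b → Lʸ (a ++ b) ≡ Lʸ a ++ Lʸ b
  L-++ = concatMap-++ (Lletter _≟_ y)

  L-∷ʳ : ∀ v c → Lʸ (v ++ c ∷ []) ≡ Lʸ v ++ Lletter _≟_ y c
  L-∷ʳ v c = trans (L-++ v (c ∷ [])) (cong (Lʸ v ++_) (++-identityʳ (Lletter _≟_ y c)))

  length-L-++ : ∀ a r → length (Lʸ a) + length r ≤ length (Lʸ (a ++ r))
  length-L-++ a r = begin
    length (Lʸ a) + length r       ≤⟨ +-monoʳ-≤ (length (Lʸ a)) (length≤length-L r) ⟩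
    length (Lʸ a) + length (Lʸ r)  ≡⟨ length-++ (Lʸ a) ⟨
    length (Lʸ a ++ Lʸ r)          ≡⟨ cong length (L-++ a r) ⟨
    length (Lʸ (a ++ r))           ∎
    where
    open Data.Nat.Properties.≤-Reasoning
    length≤length-L : ∀ r → length r ≤ length (Lʸ r)
    length≤length-L []      = z≤n
    length≤length-L (c ∷ r) with Lletter _≟_ y c | Lletter-head c
    ... | .(y ∷ t) | t , refl =
      s≤s (≤-trans (length≤length-L r)
                   (≤-trans (m≤n+m _ (length t)) (≤-reflexive (sym (length-++ t)))))

  Lω-from-suc : ∀ w i n → Lω-from _≟_ y w (suc i) n ≡ Lω-from _≟_ y (w ∘ suc) i n
  Lω-from-suc w i n with w (suc i) ≟ y
  Lω-from-suc w i zero          | yes _ = refl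
  Lω-from-suc w i (suc n)       | yes _ = Lω-from-suc w (suc i) n
  Lω-from-suc w i zero          | no  _ = refl
  Lω-from-suc w i (suc zero)    | no  _ = refl
  Lω-from-suc w i (suc (suc n)) | no  _ = Lω-from-suc w (suc i) n

  IsPrefix-Lletter-∷ : ∀ w v → IsPrefix v (Lωʸ (w ∘ suc)) →
                       IsPrefix (Lletter _≟_ y (w 0) ++ v) (Lωʸ w)
  IsPrefix-Lletter-∷ w v pv with w 0 ≟ y
  ... | yes _ = cong (y ∷_) (trans pv (takeω-cong _ (sym ∘ Lω-from-suc w 0)))
  ... | no  _ = cong (y ∷_) (cong (w 0 ∷_) (trans pv (takeω-cong _ (sym ∘ Lω-from-suc w 0))))

  IsPrefix-L : ∀ v w → IsPrefix v w → IsPrefix (Lʸ v) (Lωʸ w)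
  IsPrefix-L []      w pv = refl
  IsPrefix-L (c ∷ v) w pv =
    subst (λ b → IsPrefix (Lʸ (b ∷ v)) (Lωʸ w)) (sym (proj₁ (∷-injective pv)))
      (IsPrefix-Lletter-∷ w (Lʸ v) (IsPrefix-L v (w ∘ suc) (proj₂ (∷-injective pv))))

  IsPrefix-L-++ : ∀ p z w → IsPrefix (p ++ z) w → IsPrefix (Lʸ p ++ Lʸ z) (Lωʸ w)
  IsPrefix-L-++ p z w pz = subst (λ s → IsPrefix s (Lωʸ w)) (L-++ p z) (IsPrefix-L (p ++ z) w pz)

  IsPrefix-L-∷ʳ-y : ∀ v w → IsPrefix v w → IsPrefix (Lʸ v ++ y ∷ []) (Lωʸ w)
  IsPrefix-L-∷ʳ-y v w pv = IsPrefix-++⁻ˡ (Lʸ v ++ y ∷ []) t (subst (λ s → IsPrefix s (Lωʸ w)) image≡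
    (IsPrefix-L (v ++ c ∷ []) w (IsPrefix-∷ʳ-next v pv)))
    where
    c = w (length v)
    t = proj₁ (Lletter-head c)
    image≡ : Lʸ (v ++ c ∷ []) ≡ (Lʸ v ++ y ∷ []) ++ t
    image≡ = begin
      Lʸ (v ++ c ∷ [])          ≡⟨ L-∷ʳ v c ⟩
      Lʸ v ++ Lletter _≟_ y c   ≡⟨ cong (Lʸ v ++_) (proj₂ (Lletter-head c)) ⟩
      Lʸ v ++ y ∷ t             ≡⟨ ++-assoc (Lʸ v) (y ∷ []) t ⟨
      (Lʸ v ++ y ∷ []) ++ t     ∎
      where open ≡-Reasoning

  IsPrefix-L-++-y : ∀ p z w → IsPrefix (p ++ z) w → IsPrefix (Lʸ p ++ Lʸ z ++ y ∷ []) (Lωʸ w)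
  IsPrefix-L-++-y p z w pz = subst (λ s → IsPrefix s (Lωʸ w))
    (trans (cong (_++ y ∷ []) (L-++ p z)) (++-assoc (Lʸ p) (Lʸ z) (y ∷ [])))
    (IsPrefix-L-∷ʳ-y (p ++ z) w pz)

  length-L-<-++ : ∀ a r → length a < length (a ++ r) → length (Lʸ a) < length (Lʸ (a ++ r))
  length-L-<-++ a r a<a++r = begin-strict
    length (Lʸ a)             ≡⟨ +-identityʳ _ ⟨
    length (Lʸ a) + 0         <⟨ +-monoʳ-< (length (Lʸ a)) r-nonempty ⟩
    length (Lʸ a) + length r  ≤⟨ length-L-++ a r ⟩
    length (Lʸ (a ++ r))      ∎
    where
    open Data.Nat.Properties.≤-Reasoning
    r-nonempty : 0 < length r
    r-nonempty = +-cancelˡ-< (length a) 0 (length r) (begin-strict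
      length a + 0         ≡⟨ +-identityʳ _ ⟩
      length a             <⟨ a<a++r ⟩
      length (a ++ r)      ≡⟨ length-++ a ⟩
      length a + length r  ∎)

  Lifts : (List A → Set) → (List A → Set) → Word∞ A → Set
  Lifts Z Z′ w = ∀ p z → Z z → IsPrefix (p ++ z) w →
    Σ (List A) λ z′ → Z′ z′ × length (Lʸ z) ≤ length z′ × IsPrefix (Lʸ p ++ z′) (Lωʸ w)

  Covers-L : ∀ {Z Z′ w} → Lifts Z Z′ w → Covers Z w → Covers Z′ (Lωʸ w)
  Covers-L {Z} {Z′} {w} lift (p , z , p₀≡[] , z∈Z , prefix , grows , overlaps) =
    Lʸ ∘ p , z′ , cong Lʸ p₀≡[] , proj₁ ∘ proj₂ ∘ lifted , proj₂ ∘ proj₂ ∘ proj₂ ∘ lifted ,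
    grows′ , overlaps′
    where
    lifted : ∀ n → Σ (List A) λ z′ → Z′ z′ × length (Lʸ (z n)) ≤ length z′ × IsPrefix (Lʸ (p n) ++ z′) (Lωʸ w)
    lifted n = lift (p n) (z n) (z∈Z n) (prefix n)

    z′ : ℕ → List A
    z′ = proj₁ ∘ lifted

    p-prefix : ∀ n → IsPrefix (p n) w
    p-prefix n = IsPrefix-++⁻ˡ (p n) (z n) (prefix n)

    grows′ : ∀ n → length (Lʸ (p n)) < length (Lʸ (p (suc n)))
    grows′ n with IsPrefix-≤⇒++ (p n) (p (suc n)) (p-prefix n) (p-prefix (suc n)) (<⇒≤ (grows n))
    ... | r , p₊≡p++r =
      subst (λ s → length (Lʸ (p n)) < length (Lʸ s)) (sym p₊≡p++r)
        (length-L-<-++ (p n) r (subst (λ s → length (p n) < length s) p₊≡p++r (grows n)))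

    overlaps′ : ∀ n → length (Lʸ (p (suc n))) ≤ length (Lʸ (p n) ++ z′ n)
    overlaps′ n with IsPrefix-≤⇒++ (p (suc n)) (p n ++ z n) (p-prefix (suc n)) (prefix n) (overlaps n)
    ... | r , window≡p₊++r = begin
      length (Lʸ (p (suc n)))                ≤⟨ m≤m+n _ (length r) ⟩
      length (Lʸ (p (suc n))) + length r     ≤⟨ length-L-++ (p (suc n)) r ⟩
      length (Lʸ (p (suc n) ++ r))           ≡⟨ cong (length ∘ Lʸ) window≡p₊++r ⟨
      length (Lʸ (p n ++ z n))               ≡⟨ cong length (L-++ (p n) (z n)) ⟩
      length (Lʸ (p n) ++ Lʸ (z n))          ≡⟨ length-++ (Lʸ (p n)) ⟩
      length (Lʸ (p n)) + length (Lʸ (z n))  ≤⟨ +-monoʳ-≤ (length (Lʸ (p n))) (proj₁ (proj₂ (proj₂ (lifted n)))) ⟩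
      length (Lʸ (p n)) + length (z′ n)      ≡⟨ length-++ (Lʸ (p n)) ⟨
      length (Lʸ (p n) ++ z′ n)              ∎
      where open Data.Nat.Properties.≤-Reasoning

lemma5p2 : {A : Set} (_≟_ : (a b : A) → Dec (a ≡ b))
    (w : Word∞ A) (y : A) (X : A → Set) (u : List A) →
    Covers (λ v → (v ≡ u) ⊎ Σ A (λ x → (X x ⊎ x ≡ y) × (v ≡ u ++ x ∷ []))) w →
    Covers (λ v → (v ≡ L _≟_ y u ++ y ∷ [])
                  ⊎ Σ A (λ x → (X x × ¬ (x ≡ y)) × (v ≡ L _≟_ y u ++ y ∷ x ∷ [])))
           (Lω _≟_ y w)
lemma5p2 {A} _≟_ w y X u = Covers-L {Z} {Z′} lift
  where
  open Morphism _≟_ y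

  Z Z′ : List A → Set
  Z v = (v ≡ u) ⊎ Σ A (λ x → (X x ⊎ x ≡ y) × (v ≡ u ++ x ∷ []))
  Z′ v = (v ≡ Lʸ u ++ y ∷ []) ⊎ Σ A (λ x → (X x × ¬ (x ≡ y)) × (v ≡ Lʸ u ++ y ∷ x ∷ []))

  lift-image : ∀ p {z z′} → Lʸ z ≡ z′ → IsPrefix (p ++ z) w →
               length (Lʸ z) ≤ length z′ × IsPrefix (Lʸ p ++ z′) (Lωʸ w)
  lift-image p {z} refl pz = ≤-refl , IsPrefix-L-++ p z w pz

  lift : Lifts Z Z′ w
  lift p _ (inj₁ refl) pz = Lʸ u ++ y ∷ [] , inj₁ refl , length-++-≤ˡ (Lʸ u) , IsPrefix-L-++-y p u w pz
  lift p _ (inj₂ (x , x∈X⊎x≡y , refl)) pz with x ≟ y | x∈X⊎x≡y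
  ... | yes refl | _        = Lʸ u ++ y ∷ [] , inj₁ refl ,
                              lift-image p (trans (L-∷ʳ u y) (cong (Lʸ u ++_) Lletter-≡)) pz
  ... | no x≢y   | inj₂ x≡y = ⊥-elim (x≢y x≡y)
  ... | no x≢y   | inj₁ x∈X = Lʸ u ++ y ∷ x ∷ [] , inj₂ (x , (x∈X , x≢y) , refl) ,
                              lift-image p (trans (L-∷ʳ u x) (cong (Lʸ u ++_) (Lletter-≢ x≢y))) pz
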